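{- For every sequent $\Gamma\Rightarrow\beta$: $\vdash_{\mathsf{Gb}}\Gamma\Rightarrow\beta$ if and only if $\Gamma\Rightarrow\beta$ is derivable in $\mathsf{Gb}$ without any application of the rule $(\mathrm{Cut})$.
   Context: Formulas of $\mathsf{Gb}$: variables $p$, the constant $\bot$, and $\alpha\cdot\beta$, $\alpha\backslash\beta$, $\alpha\wedge\beta$, $\alpha\vee\beta$, $\alpha\ast\beta$, $\alpha\rightarrow\beta$. Formula structures: every formula is a structure, and if $\Gamma,\Delta$ are structures so are $(\Gamma,\Delta)$ and $(\Gamma;\Delta)$. A context $\Gamma[-]$ is a structure with one designated hole; $\Gamma[\Delta]$ is the result of filling it with $\Delta$. A sequent is $\Gamma\Rightarrow\alpha$ with $\Gamma$ a structure and $\alpha$ a formula. Rules of $\mathsf{Gb}$ (premises / conclusion): $(\mathrm{Id})$ $\alpha\Rightarrow\alpha$; $(\cdot\mathrm{L})$ $\Gamma[\alpha,\beta]\Rightarrow\gamma$ / $\Gamma[\alpha\cdot\beta]\Rightarrow\gamma$; $(\cdot\mathrm{R})$ $\Gamma_1\Rightarrow\alpha$, $\Gamma_2\Rightarrow\beta$ / $\Gamma_1,\Gamma_2\Rightarrow\alpha\cdot\beta$; $(\ast\mathrm{L})$ $\Gamma[\alpha;\beta]\Rightarrow\gamma$ / $\Gamma[\alpha\ast\beta]\Rightarrow\gamma$; $(\ast\mathrm{R})$ $\Gamma_1\Rightarrow\alpha$, $\Gamma_2\Rightarrow\beta$ / $\Gamma_1;\Gamma_2\Rightarrow\alpha\ast\beta$;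 $(\backslash\mathrm{L})$ $\Delta\Rightarrow\alpha$, $\Gamma[\beta]\Rightarrow\gamma$ / $\Gamma[\Delta,\alpha\backslash\beta]\Rightarrow\gamma$; $(\backslash\mathrm{R})$ $\alpha,\Gamma\Rightarrow\beta$ / $\Gamma\Rightarrow\alpha\backslash\beta$; $(\rightarrow\mathrm{L})$ $\Delta\Rightarrow\alpha$, $\Gamma[\beta]\Rightarrow\gamma$ / $\Gamma[\Delta;\alpha\rightarrow\beta]\Rightarrow\gamma$; $(\rightarrow\mathrm{R})$ $\alpha;\Gamma\Rightarrow\beta$ / $\Gamma\Rightarrow\alpha\rightarrow\beta$; $(\wedge\mathrm{L})$ $\Gamma[\alpha]\Rightarrow\beta$ / $\Gamma[\alpha\wedge\gamma]\Rightarrow\beta$ and $\Gamma[\alpha]\Rightarrow\beta$ / $\Gamma[\gamma\wedge\alpha]\Rightarrow\beta$; $(\wedge\mathrm{R})$ $\Gamma\Rightarrow\alpha$, $\Gamma\Rightarrow\beta$ / $\Gamma\Rightarrow\alpha\wedge\beta$; $(\vee\mathrm{L})$ $\Gamma[\alpha]\Rightarrow\gamma$, $\Gamma[\beta]\Rightarrow\gamma$ / $\Gamma[\alpha\vee\beta]\Rightarrow\gamma$; $(\vee\mathrm{R})$ $\Gamma\Rightarrow\alpha$ / $\Gamma\Rightarrow\alpha\vee\beta$ and $\Gamma\Rightarrow\alpha$ / $\Gamma\Rightarrow\beta\vee\alpha$; $(\bot)$ $\Delta\Rightarrow\bot$ / $\Gamma[\Delta]\Rightarrow\alpha$; $(\mathrm{Cut})$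 $\Delta\Rightarrow\alpha$, $\Gamma[\alpha]\Rightarrow\beta$ / $\Gamma[\Delta]\Rightarrow\beta$; $(\mathrm{R}\text{ - }\bot)$ $(\Delta_1,\Delta_2);\Delta_3\Rightarrow\bot$ / $(\Delta_1,\Delta_3);\Delta_2\Rightarrow\bot$; $(\mathrm{Ex})$ $\Gamma[\Delta_1,\Delta_2]\Rightarrow\beta$ / $\Gamma[\Delta_2,\Delta_1]\Rightarrow\beta$; $(\mathrm{Ex}^;)$ $\Gamma[\Delta_1;\Delta_2]\Rightarrow\beta$ / $\Gamma[\Delta_2;\Delta_1]\Rightarrow\beta$; $(\mathrm{As}_1)$ $\Gamma[\Delta_1,(\Delta_2,\Delta_3)]\Rightarrow\beta$ / $\Gamma[(\Delta_1,\Delta_2),\Delta_3]\Rightarrow\beta$; $(\mathrm{As}_2)$ the converse of $(\mathrm{As}_1)$. -}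

module Defs where

open import Data.Nat using (ℕ)
open import Data.Bool using (Bool; true; false)
open import Relation.Binary.PropositionalEquality using (_≡_)

data Fm : Set where
  var  : ℕ → Fm
  ⊥'   : Fm
  _·_  : Fm → Fm → Fm
  _＼_ : Fm → Fm → Fm
  _∧_  : Fm → Fm → Fm
  _∨_  : Fm → Fm → Fm
  _⊛_  : Fm → Fm → Fm
  _⟶_  : Fm → Fm → Fm

data Str : Set where
  fm   : Fm → Str
  _,,_ : Str → Str → Str
  _⨾_  : Str → Str → Str

data Ctx : Set where
  ∙    : Ctx
  _,ₗ_ : Ctx → Str → Ctx
  _,ᵣ_ : Str → Ctx → Ctx
  _⨾ₗ_ : Ctx → Str → Ctx
  _⨾ᵣ_ : Str → Ctx → Ctx

_[_] : Ctx → Str → Str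
∙ [ Δ ] = Δ
(Γ ,ₗ Θ) [ Δ ] = (Γ [ Δ ]) ,, Θ
(Θ ,ᵣ Γ) [ Δ ] = Θ ,, (Γ [ Δ ])
(Γ ⨾ₗ Θ) [ Δ ] = (Γ [ Δ ]) ⨾ Θ
(Θ ⨾ᵣ Γ) [ Δ ] = Θ ⨾ (Γ [ Δ ])

infix 4 _⊢_⇒_

-- Derivability in Gb.  The flag c says whether (Cut) may be used:
-- c ≡ true : full Gb;  c ≡ false : cut-free derivations.
data _⊢_⇒_ (c : Bool) : Str → Fm → Set where
  id   : ∀ {α} → c ⊢ fm α ⇒ α
  ·L   : ∀ {Γ α β γ} → c ⊢ Γ [ fm α ,, fm β ] ⇒ γ → c ⊢ Γ [ fm (α · β) ] ⇒ γ
  ·R   : ∀ {Γ₁ Γ₂ α β} → c ⊢ Γ₁ ⇒ α → c ⊢ Γ₂ ⇒ β → c ⊢ Γ₁ ,, Γ₂ ⇒ α · β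
  ⊛L   : ∀ {Γ α β γ} → c ⊢ Γ [ fm α ⨾ fm β ] ⇒ γ → c ⊢ Γ [ fm (α ⊛ β) ] ⇒ γ
  ⊛R   : ∀ {Γ₁ Γ₂ α β} → c ⊢ Γ₁ ⇒ α → c ⊢ Γ₂ ⇒ β → c ⊢ Γ₁ ⨾ Γ₂ ⇒ α ⊛ β
  ＼L  : ∀ {Γ Δ α β γ} → c ⊢ Δ ⇒ α → c ⊢ Γ [ fm β ] ⇒ γ
         → c ⊢ Γ [ Δ ,, fm (α ＼ β) ] ⇒ γ
  ＼R  : ∀ {Γ α β} → c ⊢ fm α ,, Γ ⇒ β → c ⊢ Γ ⇒ α ＼ β
  ⇒L   : ∀ {Γ Δ α β γ} → c ⊢ Δ ⇒ α → c ⊢ Γ [ fm β ] ⇒ γ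
         → c ⊢ Γ [ Δ ⨾ fm (α ⟶ β) ] ⇒ γ
  ⇒R   : ∀ {Γ α β} → c ⊢ fm α ⨾ Γ ⇒ β → c ⊢ Γ ⇒ α ⟶ β
  ∧L₁  : ∀ {Γ α β γ} → c ⊢ Γ [ fm α ] ⇒ β → c ⊢ Γ [ fm (α ∧ γ) ] ⇒ β
  ∧L₂  : ∀ {Γ α β γ} → c ⊢ Γ [ fm α ] ⇒ β → c ⊢ Γ [ fm (γ ∧ α) ] ⇒ β
  ∧R   : ∀ {Γ α β} → c ⊢ Γ ⇒ α → c ⊢ Γ ⇒ β → c ⊢ Γ ⇒ α ∧ β
  ∨L   : ∀ {Γ α β γ} → c ⊢ Γ [ fm α ] ⇒ γ → c ⊢ Γ [ fm β ] ⇒ γ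
         → c ⊢ Γ [ fm (α ∨ β) ] ⇒ γ
  ∨R₁  : ∀ {Γ α β} → c ⊢ Γ ⇒ α → c ⊢ Γ ⇒ α ∨ β
  ∨R₂  : ∀ {Γ α β} → c ⊢ Γ ⇒ α → c ⊢ Γ ⇒ β ∨ α
  ⊥R   : ∀ {Γ Δ α} → c ⊢ Δ ⇒ ⊥' → c ⊢ Γ [ Δ ] ⇒ α
  cut  : ∀ {Γ Δ α β} → c ≡ true → c ⊢ Δ ⇒ α → c ⊢ Γ [ fm α ] ⇒ β
         → c ⊢ Γ [ Δ ] ⇒ β
  R⊥   : ∀ {Δ₁ Δ₂ Δ₃} → c ⊢ (Δ₁ ,, Δ₂) ⨾ Δ₃ ⇒ ⊥' → c ⊢ (Δ₁ ,, Δ₃) ⨾ Δ₂ ⇒ ⊥'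
  ex   : ∀ {Γ Δ₁ Δ₂ β} → c ⊢ Γ [ Δ₁ ,, Δ₂ ] ⇒ β → c ⊢ Γ [ Δ₂ ,, Δ₁ ] ⇒ β
  ex⨾  : ∀ {Γ Δ₁ Δ₂ β} → c ⊢ Γ [ Δ₁ ⨾ Δ₂ ] ⇒ β → c ⊢ Γ [ Δ₂ ⨾ Δ₁ ] ⇒ β
  as₁  : ∀ {Γ Δ₁ Δ₂ Δ₃ β} → c ⊢ Γ [ Δ₁ ,, (Δ₂ ,, Δ₃) ] ⇒ β
         → c ⊢ Γ [ (Δ₁ ,, Δ₂) ,, Δ₃ ] ⇒ β
  as₂  : ∀ {Γ Δ₁ Δ₂ Δ₃ β} → c ⊢ Γ [ (Δ₁ ,, Δ₂) ,, Δ₃ ] ⇒ β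
         → c ⊢ Γ [ Δ₁ ,, (Δ₂ ,, Δ₃) ] ⇒ β

Gb⊢ : Str → Fm → Set
Gb⊢ Γ β = true ⊢ Γ ⇒ β

GbCF⊢ : Str → Fm → Set
GbCF⊢ Γ β = false ⊢ Γ ⇒ β

-- Cut is admissible in the cut-free system, by the usual double induction: on the cut
-- formula, and then on the derivation of the left premise until it ends in a right rule,
-- and on the derivation of the right premise until the cut formula becomes principal.
-- Left rules, structural rules and (⊥) act at an arbitrary position Γ[-] of a structure;
-- the cut formula either lies inside the structure they rewrite or apart from it, and in
-- both cases the cut permutes upwards.  (R-⊥) only ever concludes ⊥, so a left premise
-- ending in it is absorbed by (⊥).
module Submission where

open import Defs
open import Data.Bool using (true; false)
open import Data.Product using (_×_; _,_)
open import Relation.Binary.PropositionalEquality using (_≡_; refl; sym; cong; subst)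

cast : ∀ {c S T γ} → S ≡ T → c ⊢ S ⇒ γ → c ⊢ T ⇒ γ
cast {c} {γ = γ} = subst (λ S → c ⊢ S ⇒ γ)

infixr 9 _∘ᶜ_

_∘ᶜ_ : Ctx → Ctx → Ctx
∙ ∘ᶜ D = D
(C ,ₗ S) ∘ᶜ D = (C ∘ᶜ D) ,ₗ S
(S ,ᵣ C) ∘ᶜ D = S ,ᵣ (C ∘ᶜ D)
(C ⨾ₗ S) ∘ᶜ D = (C ∘ᶜ D) ⨾ₗ S
(S ⨾ᵣ C) ∘ᶜ D = S ⨾ᵣ (C ∘ᶜ D)

∘ᶜ-[] : ∀ C D X → (C ∘ᶜ D) [ X ] ≡ C [ D [ X ] ]
∘ᶜ-[] ∙ D X = refl
∘ᶜ-[] (C ,ₗ S) D X = cong (_,, S) (∘ᶜ-[] C D X)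
∘ᶜ-[] (S ,ᵣ C) D X = cong (S ,,_) (∘ᶜ-[] C D X)
∘ᶜ-[] (C ⨾ₗ S) D X = cong (_⨾ S) (∘ᶜ-[] C D X)
∘ᶜ-[] (S ⨾ᵣ C) D X = cong (S ⨾_) (∘ᶜ-[] C D X)

nest : ∀ {c} Γ C {X γ} → c ⊢ Γ [ C [ X ] ] ⇒ γ → c ⊢ (Γ ∘ᶜ C) [ X ] ⇒ γ
nest Γ C = cast (sym (∘ᶜ-[] Γ C _))

unnest : ∀ {c} Γ C {X γ} → c ⊢ (Γ ∘ᶜ C) [ X ] ⇒ γ → c ⊢ Γ [ C [ X ] ] ⇒ γ
unnest Γ C = cast (∘ᶜ-[] Γ C _)

ContextRule : Str → Str → Set
ContextRule P Q = ∀ {Γ γ} → false ⊢ Γ [ P ] ⇒ γ → false ⊢ Γ [ Q ] ⇒ γ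

inContext : ∀ C {P Q} → ContextRule P Q → ContextRule (C [ P ]) (C [ Q ])
inContext C rule {Γ} d = unnest Γ C (rule {Γ ∘ᶜ C} (nest Γ C d))

rearrange : ∀ Γ {K} C {Δ γ} → ContextRule (K [ Δ ]) (C [ Δ ]) → false ⊢ (Γ ∘ᶜ K) [ Δ ] ⇒ γ → false ⊢ (Γ ∘ᶜ C) [ Δ ] ⇒ γ
rearrange Γ {K} C rule d = nest Γ C (rule {Γ} (unnest Γ K d))

-- C ,₁₂ D is (C[-₁] , D[-₂]) and C ,₂₁ D is (C[-₂] , D[-₁]); likewise for ⨾.
data Ctx₂ : Set where
  _,₁₂_ _,₂₁_ _⨾₁₂_ _⨾₂₁_ : Ctx → Ctx → Ctx₂
  _,ₗ₂_ : Ctx₂ → Str → Ctx₂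
  _,ᵣ₂_ : Str → Ctx₂ → Ctx₂
  _⨾ₗ₂_ : Ctx₂ → Str → Ctx₂
  _⨾ᵣ₂_ : Str → Ctx₂ → Ctx₂

plug₁ : Ctx₂ → Str → Ctx
plug₁ (C ,₁₂ D) A = (C [ A ]) ,ᵣ D
plug₁ (C ,₂₁ D) A = C ,ₗ (D [ A ])
plug₁ (C ⨾₁₂ D) A = (C [ A ]) ⨾ᵣ D
plug₁ (C ⨾₂₁ D) A = C ⨾ₗ (D [ A ])
plug₁ (T ,ₗ₂ S) A = plug₁ T A ,ₗ S
plug₁ (S ,ᵣ₂ T) A = S ,ᵣ plug₁ T A
plug₁ (T ⨾ₗ₂ S) A = plug₁ T A ⨾ₗ S
plug₁ (S ⨾ᵣ₂ T) A = S ⨾ᵣ plug₁ T A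

plug₂ : Ctx₂ → Str → Ctx
plug₂ (C ,₁₂ D) B = C ,ₗ (D [ B ])
plug₂ (C ,₂₁ D) B = (C [ B ]) ,ᵣ D
plug₂ (C ⨾₁₂ D) B = C ⨾ₗ (D [ B ])
plug₂ (C ⨾₂₁ D) B = (C [ B ]) ⨾ᵣ D
plug₂ (T ,ₗ₂ S) B = plug₂ T B ,ₗ S
plug₂ (S ,ᵣ₂ T) B = S ,ᵣ plug₂ T B
plug₂ (T ⨾ₗ₂ S) B = plug₂ T B ⨾ₗ S
plug₂ (S ⨾ᵣ₂ T) B = S ⨾ᵣ plug₂ T B

plug-comm : ∀ T A B → plug₁ T A [ B ] ≡ plug₂ T B [ A ]
plug-comm (C ,₁₂ D) A B = refl
plug-comm (C ,₂₁ D) A B = refl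
plug-comm (C ⨾₁₂ D) A B = refl
plug-comm (C ⨾₂₁ D) A B = refl
plug-comm (T ,ₗ₂ S) A B = cong (_,, S) (plug-comm T A B)
plug-comm (S ,ᵣ₂ T) A B = cong (S ,,_) (plug-comm T A B)
plug-comm (T ⨾ₗ₂ S) A B = cong (_⨾ S) (plug-comm T A B)
plug-comm (S ⨾ᵣ₂ T) A B = cong (S ⨾_) (plug-comm T A B)

commute : ∀ T {P Q Δ γ} → ContextRule P Q → false ⊢ plug₂ T P [ Δ ] ⇒ γ → false ⊢ plug₂ T Q [ Δ ] ⇒ γ
commute T {Δ = Δ} rule d = cast (plug-comm T Δ _) (rule {plug₁ T Δ} (cast (sym (plug-comm T Δ _)) d))

-- A hole cannot lie strictly inside a formula, so a substructure X and an occurrence of α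
-- in the same structure are either nested or disjoint.
data Overlap (Γ' : Ctx) (X : Str) (Γ : Ctx) (α : Fm) : Set where
  nested : (C : Ctx) → X ≡ C [ fm α ] → Γ ≡ Γ' ∘ᶜ C → Overlap Γ' X Γ α
  apart  : (T : Ctx₂) → Γ' ≡ plug₁ T (fm α) → Γ ≡ plug₂ T X → Overlap Γ' X Γ α

,,-injective : ∀ {A B C D} → (A ,, B) ≡ (C ,, D) → A ≡ C × B ≡ D
,,-injective refl = refl , refl

⨾-injective : ∀ {A B C D} → (A ⨾ B) ≡ (C ⨾ D) → A ≡ C × B ≡ D
⨾-injective refl = refl , refl

overlapView : ∀ Γ' X Γ α → Γ' [ X ] ≡ Γ [ fm α ] → Overlap Γ' X Γ α
overlapView ∙ X Γ α p = nested Γ p refl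
overlapView (C ,ₗ S) X (D ,ₗ S') α p with ,,-injective p
... | q , refl with overlapView C X D α q
...   | nested C' e refl = nested C' e refl
...   | apart T refl refl = apart (T ,ₗ₂ S) refl refl
overlapView (C ,ₗ S) X (S' ,ᵣ D) α p with ,,-injective p
... | q₁ , q₂ = apart (C ,₂₁ D) (cong (C ,ₗ_) q₂) (cong (_,ᵣ D) (sym q₁))
overlapView (S ,ᵣ C) X (D ,ₗ S') α p with ,,-injective p
... | q₁ , q₂ = apart (D ,₁₂ C) (cong (_,ᵣ C) q₁) (cong (D ,ₗ_) (sym q₂))
overlapView (S ,ᵣ C) X (S' ,ᵣ D) α p with ,,-injective p
... | refl , q with overlapView C X D α q
...   | nested C' e refl = nested C' e refl
...   | apart T refl refl = apart (S ,ᵣ₂ T) refl refl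
overlapView (C ⨾ₗ S) X (D ⨾ₗ S') α p with ⨾-injective p
... | q , refl with overlapView C X D α q
...   | nested C' e refl = nested C' e refl
...   | apart T refl refl = apart (T ⨾ₗ₂ S) refl refl
overlapView (C ⨾ₗ S) X (S' ⨾ᵣ D) α p with ⨾-injective p
... | q₁ , q₂ = apart (C ⨾₂₁ D) (cong (C ⨾ₗ_) q₂) (cong (_⨾ᵣ D) (sym q₁))
overlapView (S ⨾ᵣ C) X (D ⨾ₗ S') α p with ⨾-injective p
... | q₁ , q₂ = apart (D ⨾₁₂ C) (cong (_⨾ᵣ C) q₁) (cong (D ⨾ₗ_) (sym q₂))
overlapView (S ⨾ᵣ C) X (S' ⨾ᵣ D) α p with ⨾-injective p
... | refl , q with overlapView C X D α q
...   | nested C' e refl = nested C' e refl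
...   | apart T refl refl = apart (S ⨾ᵣ₂ T) refl refl

data RightRule : Str → Fm → Set where
  r·  : ∀ {Γ₁ Γ₂ a b} → false ⊢ Γ₁ ⇒ a → false ⊢ Γ₂ ⇒ b → RightRule (Γ₁ ,, Γ₂) (a · b)
  r⊛  : ∀ {Γ₁ Γ₂ a b} → false ⊢ Γ₁ ⇒ a → false ⊢ Γ₂ ⇒ b → RightRule (Γ₁ ⨾ Γ₂) (a ⊛ b)
  r＼ : ∀ {Γ a b} → false ⊢ fm a ,, Γ ⇒ b → RightRule Γ (a ＼ b)
  r⟶  : ∀ {Γ a b} → false ⊢ fm a ⨾ Γ ⇒ b → RightRule Γ (a ⟶ b)
  r∧  : ∀ {Γ a b} → false ⊢ Γ ⇒ a → false ⊢ Γ ⇒ b → RightRule Γ (a ∧ b)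
  r∨₁ : ∀ {Γ a b} → false ⊢ Γ ⇒ a → RightRule Γ (a ∨ b)
  r∨₂ : ∀ {Γ a b} → false ⊢ Γ ⇒ b → RightRule Γ (a ∨ b)

RightRule⇒⊢ : ∀ {Δ α} → RightRule Δ α → false ⊢ Δ ⇒ α
RightRule⇒⊢ (r· d e) = ·R d e
RightRule⇒⊢ (r⊛ d e) = ⊛R d e
RightRule⇒⊢ (r＼ d) = ＼R d
RightRule⇒⊢ (r⟶ d) = ⇒R d
RightRule⇒⊢ (r∧ d e) = ∧R d e
RightRule⇒⊢ (r∨₁ d) = ∨R₁ d
RightRule⇒⊢ (r∨₂ d) = ∨R₂ d

CutsInto : Str → Fm → Str → Fm → Set
CutsInto Δ α S γ = ∀ Γ → S ≡ Γ [ fm α ] → false ⊢ Γ [ Δ ] ⇒ γ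

cut-admissible : ∀ {α Δ} → false ⊢ Δ ⇒ α → ContextRule (fm α) Δ
cut-rightRule : ∀ {α Δ S γ} → RightRule Δ α → false ⊢ S ⇒ γ → CutsInto Δ α S γ
cut-⊥R : ∀ {α Δ γ} → RightRule Δ α → ∀ Γ' {X} → false ⊢ X ⇒ ⊥' → CutsInto Δ α (Γ' [ X ]) γ
cut-·L : ∀ {α Δ γ} → RightRule Δ α → ∀ Γ' {a b} → false ⊢ Γ' [ fm a ,, fm b ] ⇒ γ → CutsInto Δ α (Γ' [ fm (a · b) ]) γ
cut-⊛L : ∀ {α Δ γ} → RightRule Δ α → ∀ Γ' {a b} → false ⊢ Γ' [ fm a ⨾ fm b ] ⇒ γ → CutsInto Δ α (Γ' [ fm (a ⊛ b) ]) γ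
cut-∧L₁ : ∀ {α Δ γ} → RightRule Δ α → ∀ Γ' {a b} → false ⊢ Γ' [ fm a ] ⇒ γ → CutsInto Δ α (Γ' [ fm (a ∧ b) ]) γ
cut-∧L₂ : ∀ {α Δ γ} → RightRule Δ α → ∀ Γ' {a b} → false ⊢ Γ' [ fm b ] ⇒ γ → CutsInto Δ α (Γ' [ fm (a ∧ b) ]) γ
cut-∨L : ∀ {α Δ γ} → RightRule Δ α → ∀ Γ' {a b} → false ⊢ Γ' [ fm a ] ⇒ γ → false ⊢ Γ' [ fm b ] ⇒ γ
         → CutsInto Δ α (Γ' [ fm (a ∨ b) ]) γ
cut-＼L : ∀ {α Δ γ} → RightRule Δ α → ∀ Γ' {Δ' a b} → false ⊢ Δ' ⇒ a → false ⊢ Γ' [ fm b ] ⇒ γ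
         → CutsInto Δ α (Γ' [ Δ' ,, fm (a ＼ b) ]) γ
cut-⇒L : ∀ {α Δ γ} → RightRule Δ α → ∀ Γ' {Δ' a b} → false ⊢ Δ' ⇒ a → false ⊢ Γ' [ fm b ] ⇒ γ
         → CutsInto Δ α (Γ' [ Δ' ⨾ fm (a ⟶ b) ]) γ
cut-ex : ∀ {α Δ γ} → RightRule Δ α → ∀ Γ' {Δ₁ Δ₂} → false ⊢ Γ' [ Δ₁ ,, Δ₂ ] ⇒ γ → CutsInto Δ α (Γ' [ Δ₂ ,, Δ₁ ]) γ
cut-ex⨾ : ∀ {α Δ γ} → RightRule Δ α → ∀ Γ' {Δ₁ Δ₂} → false ⊢ Γ' [ Δ₁ ⨾ Δ₂ ] ⇒ γ → CutsInto Δ α (Γ' [ Δ₂ ⨾ Δ₁ ]) γ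
cut-as₁ : ∀ {α Δ γ} → RightRule Δ α → ∀ Γ' {Δ₁ Δ₂ Δ₃} → false ⊢ Γ' [ Δ₁ ,, (Δ₂ ,, Δ₃) ] ⇒ γ
          → CutsInto Δ α (Γ' [ (Δ₁ ,, Δ₂) ,, Δ₃ ]) γ
cut-as₂ : ∀ {α Δ γ} → RightRule Δ α → ∀ Γ' {Δ₁ Δ₂ Δ₃} → false ⊢ Γ' [ (Δ₁ ,, Δ₂) ,, Δ₃ ] ⇒ γ
          → CutsInto Δ α (Γ' [ Δ₁ ,, (Δ₂ ,, Δ₃) ]) γ

cut-admissible id e = e
cut-admissible (·L {C} d) {Γ} e = inContext C ·L {Γ} (cut-admissible d {Γ} e)
cut-admissible (⊛L {C} d) {Γ} e = inContext C ⊛L {Γ} (cut-admissible d {Γ} e)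
cut-admissible (∧L₁ {C} d) {Γ} e = inContext C ∧L₁ {Γ} (cut-admissible d {Γ} e)
cut-admissible (∧L₂ {C} d) {Γ} e = inContext C ∧L₂ {Γ} (cut-admissible d {Γ} e)
cut-admissible (＼L {C} d₁ d₂) {Γ} e = inContext C (＼L d₁) {Γ} (cut-admissible d₂ {Γ} e)
cut-admissible (⇒L {C} d₁ d₂) {Γ} e = inContext C (⇒L d₁) {Γ} (cut-admissible d₂ {Γ} e)
cut-admissible (ex {C} d) {Γ} e = inContext C ex {Γ} (cut-admissible d {Γ} e)
cut-admissible (ex⨾ {C} d) {Γ} e = inContext C ex⨾ {Γ} (cut-admissible d {Γ} e)
cut-admissible (as₁ {C} d) {Γ} e = inContext C as₁ {Γ} (cut-admissible d {Γ} e)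
cut-admissible (as₂ {C} d) {Γ} e = inContext C as₂ {Γ} (cut-admissible d {Γ} e)
cut-admissible (∨L {C} d₁ d₂) {Γ} e =
  unnest Γ C (∨L {Γ = Γ ∘ᶜ C} (nest Γ C (cut-admissible d₁ {Γ} e)) (nest Γ C (cut-admissible d₂ {Γ} e)))
cut-admissible (⊥R {C} d) {Γ} e = unnest Γ C (⊥R {Γ = Γ ∘ᶜ C} d)
cut-admissible (R⊥ d) {Γ} e = ⊥R {Γ = Γ} (R⊥ d)
cut-admissible (cut () _ _)
cut-admissible (·R d₁ d₂) {Γ} e = cut-rightRule (r· d₁ d₂) e Γ refl
cut-admissible (⊛R d₁ d₂) {Γ} e = cut-rightRule (r⊛ d₁ d₂) e Γ refl
cut-admissible (＼R d) {Γ} e = cut-rightRule (r＼ d) e Γ refl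
cut-admissible (⇒R d) {Γ} e = cut-rightRule (r⟶ d) e Γ refl
cut-admissible (∧R d₁ d₂) {Γ} e = cut-rightRule (r∧ d₁ d₂) e Γ refl
cut-admissible (∨R₁ d) {Γ} e = cut-rightRule (r∨₁ d) e Γ refl
cut-admissible (∨R₂ d) {Γ} e = cut-rightRule (r∨₂ d) e Γ refl

cut-rightRule rd (cut () _ _)
cut-rightRule rd id ∙ refl = RightRule⇒⊢ rd
cut-rightRule rd (·R e₁ e₂) (C ,ₗ S) refl = ·R (cut-rightRule rd e₁ C refl) e₂
cut-rightRule rd (·R e₁ e₂) (S ,ᵣ C) refl = ·R e₁ (cut-rightRule rd e₂ C refl)
cut-rightRule rd (⊛R e₁ e₂) (C ⨾ₗ S) refl = ⊛R (cut-rightRule rd e₁ C refl) e₂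
cut-rightRule rd (⊛R e₁ e₂) (S ⨾ᵣ C) refl = ⊛R e₁ (cut-rightRule rd e₂ C refl)
cut-rightRule rd (＼R e) Γ refl = ＼R (cut-rightRule rd e (_ ,ᵣ Γ) refl)
cut-rightRule rd (⇒R e) Γ refl = ⇒R (cut-rightRule rd e (_ ⨾ᵣ Γ) refl)
cut-rightRule rd (∧R e₁ e₂) Γ p = ∧R (cut-rightRule rd e₁ Γ p) (cut-rightRule rd e₂ Γ p)
cut-rightRule rd (∨R₁ e) Γ p = ∨R₁ (cut-rightRule rd e Γ p)
cut-rightRule rd (∨R₂ e) Γ p = ∨R₂ (cut-rightRule rd e Γ p)
cut-rightRule rd (R⊥ e) ((C ,ₗ S') ⨾ₗ S) refl = R⊥ (cut-rightRule rd e ((C ,ₗ S) ⨾ₗ S') refl)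
cut-rightRule rd (R⊥ e) ((S' ,ᵣ C) ⨾ₗ S) refl = R⊥ (cut-rightRule rd e ((S' ,, S) ⨾ᵣ C) refl)
cut-rightRule rd (R⊥ {Δ₁} {Δ₂} {Δ₃} e) (S ⨾ᵣ C) refl = R⊥ (cut-rightRule rd e ((Δ₁ ,ᵣ C) ⨾ₗ Δ₃) refl)
cut-rightRule rd (⊥R {Γ'} e) = cut-⊥R rd Γ' e
cut-rightRule rd (·L {Γ'} e) = cut-·L rd Γ' e
cut-rightRule rd (⊛L {Γ'} e) = cut-⊛L rd Γ' e
cut-rightRule rd (∧L₁ {Γ'} e) = cut-∧L₁ rd Γ' e
cut-rightRule rd (∧L₂ {Γ'} e) = cut-∧L₂ rd Γ' e
cut-rightRule rd (∨L {Γ'} e₁ e₂) = cut-∨L rd Γ' e₁ e₂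
cut-rightRule rd (＼L {Γ'} e₁ e₂) = cut-＼L rd Γ' e₁ e₂
cut-rightRule rd (⇒L {Γ'} e₁ e₂) = cut-⇒L rd Γ' e₁ e₂
cut-rightRule rd (ex {Γ'} e) = cut-ex rd Γ' e
cut-rightRule rd (ex⨾ {Γ'} e) = cut-ex⨾ rd Γ' e
cut-rightRule rd (as₁ {Γ'} e) = cut-as₁ rd Γ' e
cut-rightRule rd (as₂ {Γ'} e) = cut-as₂ rd Γ' e

cut-⊥R {α} {Δ} rd Γ' {X} e Γ p with overlapView Γ' X Γ α p
... | nested C refl refl = nest Γ' C (⊥R {Γ = Γ'} (cut-rightRule rd e C refl))
... | apart T refl refl = cast (plug-comm T Δ X) (⊥R {Γ = plug₁ T Δ} e)

cut-·L {α} rd Γ' {a} {b} e Γ p with overlapView Γ' (fm (a · b)) Γ α p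
... | apart T refl refl = commute T ·L (cut-rightRule rd e (plug₂ T (fm a ,, fm b)) (plug-comm T (fm α) _))
... | nested ∙ refl refl with rd
...   | r· {Δ₁} d₁ d₂ =
  nest Γ' ∙ (inContext (Δ₁ ,ᵣ ∙) (cut-admissible d₂) {Γ'} (inContext (∙ ,ₗ fm b) (cut-admissible d₁) {Γ'} e))

cut-⊛L {α} rd Γ' {a} {b} e Γ p with overlapView Γ' (fm (a ⊛ b)) Γ α p
... | apart T refl refl = commute T ⊛L (cut-rightRule rd e (plug₂ T (fm a ⨾ fm b)) (plug-comm T (fm α) _))
... | nested ∙ refl refl with rd
...   | r⊛ {Δ₁} d₁ d₂ =
  nest Γ' ∙ (inContext (Δ₁ ⨾ᵣ ∙) (cut-admissible d₂) {Γ'} (inContext (∙ ⨾ₗ fm b) (cut-admissible d₁) {Γ'} e))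

cut-∧L₁ {α} rd Γ' {a} {b} e Γ p with overlapView Γ' (fm (a ∧ b)) Γ α p
... | apart T refl refl = commute T ∧L₁ (cut-rightRule rd e (plug₂ T (fm a)) (plug-comm T (fm α) _))
... | nested ∙ refl refl with rd
...   | r∧ d₁ d₂ = nest Γ' ∙ (cut-admissible d₁ {Γ'} e)

cut-∧L₂ {α} rd Γ' {a} {b} e Γ p with overlapView Γ' (fm (a ∧ b)) Γ α p
... | apart T refl refl = commute T ∧L₂ (cut-rightRule rd e (plug₂ T (fm b)) (plug-comm T (fm α) _))
... | nested ∙ refl refl with rd
...   | r∧ d₁ d₂ = nest Γ' ∙ (cut-admissible d₂ {Γ'} e)

cut-∨L {α} {Δ} rd Γ' {a} {b} e₁ e₂ Γ p with overlapView Γ' (fm (a ∨ b)) Γ α p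
... | apart T refl refl = cast (plug-comm T Δ _) (∨L {Γ = plug₁ T Δ}
        (cast (sym (plug-comm T Δ _)) (cut-rightRule rd e₁ (plug₂ T (fm a)) (plug-comm T (fm α) _)))
        (cast (sym (plug-comm T Δ _)) (cut-rightRule rd e₂ (plug₂ T (fm b)) (plug-comm T (fm α) _))))
... | nested ∙ refl refl with rd
...   | r∨₁ d = nest Γ' ∙ (cut-admissible d {Γ'} e₁)
...   | r∨₂ d = nest Γ' ∙ (cut-admissible d {Γ'} e₂)

cut-＼L {α} {Δ} rd Γ' {Δ'} {a} {b} e₁ e₂ Γ p with overlapView Γ' (Δ' ,, fm (a ＼ b)) Γ α p
... | apart T refl refl = commute T (＼L e₁) (cut-rightRule rd e₂ (plug₂ T (fm b)) (plug-comm T (fm α) _))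
... | nested (C ,ₗ _) refl refl = nest Γ' (C ,ₗ _) (＼L {Γ = Γ'} (cut-rightRule rd e₁ C refl) e₂)
... | nested (_ ,ᵣ ∙) refl refl with rd
...   | r＼ d = nest Γ' (Δ' ,ᵣ ∙) (cut-admissible (cut-admissible e₁ {∙ ,ₗ Δ} d) {Γ'} e₂)

cut-⇒L {α} {Δ} rd Γ' {Δ'} {a} {b} e₁ e₂ Γ p with overlapView Γ' (Δ' ⨾ fm (a ⟶ b)) Γ α p
... | apart T refl refl = commute T (⇒L e₁) (cut-rightRule rd e₂ (plug₂ T (fm b)) (plug-comm T (fm α) _))
... | nested (C ⨾ₗ _) refl refl = nest Γ' (C ⨾ₗ _) (⇒L {Γ = Γ'} (cut-rightRule rd e₁ C refl) e₂)
... | nested (_ ⨾ᵣ ∙) refl refl with rd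
...   | r⟶ d = nest Γ' (Δ' ⨾ᵣ ∙) (cut-admissible (cut-admissible e₁ {∙ ⨾ₗ Δ} d) {Γ'} e₂)

cut-ex {α} rd Γ' {Δ₁} {Δ₂} e Γ p with overlapView Γ' (Δ₂ ,, Δ₁) Γ α p
... | apart T refl refl = commute T ex (cut-rightRule rd e (plug₂ T (Δ₁ ,, Δ₂)) (plug-comm T (fm α) _))
... | nested (C ,ₗ S) refl refl =
  rearrange Γ' (C ,ₗ S) ex (cut-rightRule rd e (Γ' ∘ᶜ (S ,ᵣ C)) (sym (∘ᶜ-[] Γ' _ _)))
... | nested (S ,ᵣ C) refl refl =
  rearrange Γ' (S ,ᵣ C) ex (cut-rightRule rd e (Γ' ∘ᶜ (C ,ₗ S)) (sym (∘ᶜ-[] Γ' _ _)))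

cut-ex⨾ {α} rd Γ' {Δ₁} {Δ₂} e Γ p with overlapView Γ' (Δ₂ ⨾ Δ₁) Γ α p
... | apart T refl refl = commute T ex⨾ (cut-rightRule rd e (plug₂ T (Δ₁ ⨾ Δ₂)) (plug-comm T (fm α) _))
... | nested (C ⨾ₗ S) refl refl =
  rearrange Γ' (C ⨾ₗ S) ex⨾ (cut-rightRule rd e (Γ' ∘ᶜ (S ⨾ᵣ C)) (sym (∘ᶜ-[] Γ' _ _)))
... | nested (S ⨾ᵣ C) refl refl =
  rearrange Γ' (S ⨾ᵣ C) ex⨾ (cut-rightRule rd e (Γ' ∘ᶜ (C ⨾ₗ S)) (sym (∘ᶜ-[] Γ' _ _)))

cut-as₁ {α} rd Γ' {Δ₁} {Δ₂} {Δ₃} e Γ p with overlapView Γ' ((Δ₁ ,, Δ₂) ,, Δ₃) Γ α p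
... | apart T refl refl = commute T as₁ (cut-rightRule rd e (plug₂ T (Δ₁ ,, (Δ₂ ,, Δ₃))) (plug-comm T (fm α) _))
... | nested ((C ,ₗ S') ,ₗ S) refl refl =
  rearrange Γ' ((C ,ₗ S') ,ₗ S) as₁ (cut-rightRule rd e (Γ' ∘ᶜ (C ,ₗ (S' ,, S))) (sym (∘ᶜ-[] Γ' _ _)))
... | nested ((S' ,ᵣ C) ,ₗ S) refl refl =
  rearrange Γ' ((S' ,ᵣ C) ,ₗ S) as₁ (cut-rightRule rd e (Γ' ∘ᶜ (S' ,ᵣ (C ,ₗ S))) (sym (∘ᶜ-[] Γ' _ _)))
... | nested (_ ,ᵣ C) refl refl =
  rearrange Γ' ((Δ₁ ,, Δ₂) ,ᵣ C) as₁ (cut-rightRule rd e (Γ' ∘ᶜ (Δ₁ ,ᵣ (Δ₂ ,ᵣ C))) (sym (∘ᶜ-[] Γ' _ _)))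

cut-as₂ {α} rd Γ' {Δ₁} {Δ₂} {Δ₃} e Γ p with overlapView Γ' (Δ₁ ,, (Δ₂ ,, Δ₃)) Γ α p
... | apart T refl refl = commute T as₂ (cut-rightRule rd e (plug₂ T ((Δ₁ ,, Δ₂) ,, Δ₃)) (plug-comm T (fm α) _))
... | nested (C ,ₗ _) refl refl =
  rearrange Γ' (C ,ₗ (Δ₂ ,, Δ₃)) as₂ (cut-rightRule rd e (Γ' ∘ᶜ ((C ,ₗ Δ₂) ,ₗ Δ₃)) (sym (∘ᶜ-[] Γ' _ _)))
... | nested (S ,ᵣ (C ,ₗ S')) refl refl =
  rearrange Γ' (S ,ᵣ (C ,ₗ S')) as₂ (cut-rightRule rd e (Γ' ∘ᶜ ((S ,ᵣ C) ,ₗ S')) (sym (∘ᶜ-[] Γ' _ _)))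
... | nested (S ,ᵣ (S' ,ᵣ C)) refl refl =
  rearrange Γ' (S ,ᵣ (S' ,ᵣ C)) as₂ (cut-rightRule rd e (Γ' ∘ᶜ ((S ,, S') ,ᵣ C)) (sym (∘ᶜ-[] Γ' _ _)))

cut-elimination : ∀ {Γ β} → true ⊢ Γ ⇒ β → false ⊢ Γ ⇒ β
cut-elimination id = id
cut-elimination (·L d) = ·L (cut-elimination d)
cut-elimination (·R d e) = ·R (cut-elimination d) (cut-elimination e)
cut-elimination (⊛L d) = ⊛L (cut-elimination d)
cut-elimination (⊛R d e) = ⊛R (cut-elimination d) (cut-elimination e)
cut-elimination (＼L d e) = ＼L (cut-elimination d) (cut-elimination e)
cut-elimination (＼R d) = ＼R (cut-elimination d)
cut-elimination (⇒L d e) = ⇒L (cut-elimination d) (cut-elimination e)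
cut-elimination (⇒R d) = ⇒R (cut-elimination d)
cut-elimination (∧L₁ d) = ∧L₁ (cut-elimination d)
cut-elimination (∧L₂ d) = ∧L₂ (cut-elimination d)
cut-elimination (∧R d e) = ∧R (cut-elimination d) (cut-elimination e)
cut-elimination (∨L d e) = ∨L (cut-elimination d) (cut-elimination e)
cut-elimination (∨R₁ d) = ∨R₁ (cut-elimination d)
cut-elimination (∨R₂ d) = ∨R₂ (cut-elimination d)
cut-elimination (⊥R d) = ⊥R (cut-elimination d)
cut-elimination (cut {Γ} _ d e) = cut-admissible (cut-elimination d) {Γ} (cut-elimination e)
cut-elimination (R⊥ d) = R⊥ (cut-elimination d)
cut-elimination (ex d) = ex (cut-elimination d)
cut-elimination (ex⨾ d) = ex⨾ (cut-elimination d)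
cut-elimination (as₁ d) = as₁ (cut-elimination d)
cut-elimination (as₂ d) = as₂ (cut-elimination d)

allow-cut : ∀ {c Γ β} → c ⊢ Γ ⇒ β → true ⊢ Γ ⇒ β
allow-cut id = id
allow-cut (·L d) = ·L (allow-cut d)
allow-cut (·R d e) = ·R (allow-cut d) (allow-cut e)
allow-cut (⊛L d) = ⊛L (allow-cut d)
allow-cut (⊛R d e) = ⊛R (allow-cut d) (allow-cut e)
allow-cut (＼L d e) = ＼L (allow-cut d) (allow-cut e)
allow-cut (＼R d) = ＼R (allow-cut d)
allow-cut (⇒L d e) = ⇒L (allow-cut d) (allow-cut e)
allow-cut (⇒R d) = ⇒R (allow-cut d)
allow-cut (∧L₁ d) = ∧L₁ (allow-cut d)
allow-cut (∧L₂ d) = ∧L₂ (allow-cut d)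
allow-cut (∧R d e) = ∧R (allow-cut d) (allow-cut e)
allow-cut (∨L d e) = ∨L (allow-cut d) (allow-cut e)
allow-cut (∨R₁ d) = ∨R₁ (allow-cut d)
allow-cut (∨R₂ d) = ∨R₂ (allow-cut d)
allow-cut (⊥R d) = ⊥R (allow-cut d)
allow-cut (cut _ d e) = cut refl (allow-cut d) (allow-cut e)
allow-cut (R⊥ d) = R⊥ (allow-cut d)
allow-cut (ex d) = ex (allow-cut d)
allow-cut (ex⨾ d) = ex⨾ (allow-cut d)
allow-cut (as₁ d) = as₁ (allow-cut d)
allow-cut (as₂ d) = as₂ (allow-cut d)

theorem5 : (Γ : Str) (β : Fm) → (Gb⊢ Γ β → GbCF⊢ Γ β) × (GbCF⊢ Γ β → Gb⊢ Γ β)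
theorem5 Γ β = cut-elimination , allow-cut
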